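{- Let $B,m$ be positive integers with $m<B$ and let $a_1,\ldots,a_{3m}$ be positive integers with $\sum_{j=1}^{3m}a_j=mB$ and $B/4<a_j<B/2$ for all $j$. Let $L=mB^3+Bm(m+1)/2$ and for $i=1,\ldots,m$ let $I_i=[l_i,r_i)$ with $l_i=(i-1)B^3+\frac{(i-1)i}{2}B$ and $r_i=iB^3+\frac{i(i+1)}{2}B$. Consider the task set $\mathcal{J}\cup\widetilde{\mathcal{J}}$, where $\mathcal{J}=\{J_1,\ldots,J_{3m}\}$ with $J_j$ having deadline $L$ and execution time $p_j(t)=ia_j$ for $t\in I_i$, and $\widetilde{\mathcal{J}}=\{\widetilde{J}_1,\ldots,\widetilde{J}_m\}$ with $\widetilde{J}_i$ having deadline $l_i+B^3$ and execution time $B^3$ for every start time. Let $D$ be a feasible schedule for $\mathcal{J}\cup\widetilde{\mathcal{J}}$, in which $\widetilde{J}_i$ starts at $\widetilde{s}_i$ and completes at $\widetilde{C}_i$, and define $\widetilde{I}_i=[\widetilde{C}_i,\widetilde{s}_{i+1})$ for $i=1,\ldots,m-1$ and $\widetilde{I}_m=[\widetilde{C}_m,L)$. Then $\widetilde{I}_i\subseteq I_i$ for each $i=1,\ldots,m$.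
   Context: A (feasible) single-machine schedule for time-dependent tasks assigns to each task $J$ a start time $s\ge 0$; its completion time is $s+p(s)$, where $p$ is its execution-time function. Execution intervals $[s,s+p(s))$ of distinct tasks must be pairwise disjoint and each completion time must not exceed the task's deadline.
   Formalization: The feasible schedule D takes its start times in ℚ, and the inclusion $\widetilde{I}_i\subseteq I_i$ is asserted for the rational points of $\widetilde{I}_i$ only. -}

module Defs where

open import Data.Nat as ℕ using (ℕ; zero; suc)
open import Data.Integer using (+_)
open import Data.Rational using (ℚ; _/_; _+_; _*_; _≤_; _<_; 0ℚ)
open import Data.Rational.Properties using (_<?_)
open import Data.Product using (_×_)
open import Data.Bool using (if_then_else_)
open import Relation.Nullary using (¬_; does)
open import Relation.Binary.PropositionalEquality using (_≢_)

⟦_⟧ : ℕ → ℚ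
⟦ n ⟧ = (+ n) / 1

record Task : Set where
  field
    deadline : ℚ
    exec     : ℚ → ℚ
open Task public

completion : Task → ℚ → ℚ
completion T s = s + exec T s

Feasible : {Idx : Set} → (Idx → Task) → (Idx → ℚ) → Set
Feasible {Idx} task s =
  (∀ x → 0ℚ ≤ s x) ×
  (∀ x → completion (task x) (s x) ≤ deadline (task x)) ×
  (∀ x y → x ≢ y → ∀ t →
     ¬ ((s x ≤ t × t < completion (task x) (s x)) ×
        (s y ≤ t × t < completion (task y) (s y))))

-- The parameters of the construction (all in ℕ; the divisions by 2 are exact).
Lbig : (m B : ℕ) → ℕ
Lbig m B = m ℕ.* B ℕ.^ 3 ℕ.+ (B ℕ.* (m ℕ.* (m ℕ.+ 1))) ℕ./ 2

-- l_i and r_i for 1-based i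
lft : (B i : ℕ) → ℕ
lft B i = (i ℕ.∸ 1) ℕ.* B ℕ.^ 3 ℕ.+ (((i ℕ.∸ 1) ℕ.* i) ℕ./ 2) ℕ.* B

rgt : (B i : ℕ) → ℕ
rgt B i = i ℕ.* B ℕ.^ 3 ℕ.+ ((i ℕ.* (i ℕ.+ 1)) ℕ./ 2) ℕ.* B

-- Execution time of J_j with size a: p(t) = i*a for t ∈ I_i = [l_i, r_i), i = 1..m.
-- Conventions: the value for t < 0 is irrelevant (start times are ≥ 0);
-- for t ≥ L = r_m (outside every I_i, where p is undefined in the paper) we put
-- p(t) = L + 1, which makes any such start infeasible, as in the paper.
execJ : (m B a : ℕ) → ℚ → ℚ
execJ m B a t = go 1 m
  where
  go : ℕ → ℕ → ℚ
  go i zero    = ⟦ suc (Lbig m B) ⟧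
  go i (suc k) = if does (t <? ⟦ rgt B i ⟧) then ⟦ i ℕ.* a ⟧ else go (suc i) k

taskJ : (m B a : ℕ) → Task
taskJ m B a = record { deadline = ⟦ Lbig m B ⟧ ; exec = execJ m B a }

taskJ̃ : (B i : ℕ) → Task
taskJ̃ B i = record { deadline = ⟦ lft B i ℕ.+ B ℕ.^ 3 ⟧ ; exec = λ _ → ⟦ B ℕ.^ 3 ⟧ }

module Submission where

-- Only the tasks J̃_1, …, J̃_m matter: each occupies an interval of
-- length P = B³, and J̃_i must be finished by l_i + B³.
--   * Lower end: if C̃_i < l_i, then J̃_1, …, J̃_i all run inside [0, l_i)
--     (J̃_j for j < i by its deadline l_j + B³ ≤ l_i), so by a packing argument
--     i·B³ ≤ l_i; but l_i = (i-1)B³ + (i-1)i/2·B < i·B³ because i ≤ m < B.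
--     Hence l_i ≤ C̃_i.
--   * Upper end: s̃_{i+1} ≤ l_{i+1} - B³ ≤ r_i by the deadline of J̃_{i+1},
--     using r_i = l_{i+1}; for i = m the right end is L = r_m.
-- The file first collects the arithmetic of l_i, r_i in ℕ and the behaviour of
-- the embedding ⟦_⟧ : ℕ → ℚ, then proves a general packing lemma for pairwise
-- disjoint intervals of equal length, restricts a feasible schedule to the
-- tasks J̃, derives the two bounds for such a schedule, and combines them.

open import Defs
open import Data.Nat as ℕ using (ℕ; zero; suc)
import Data.Nat.Properties as ℕP
open import Data.Nat.DivMod using (_/_; /-monoˡ-≤; m/n≤m; *-/-assoc)
open import Data.Nat.Divisibility using (_∣_; divides; ∣m∣n⇒∣m+n; m∣m*n)
open import Data.Nat.Tactic.RingSolver using (solve-∀)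
open import Data.Integer as ℤ using (+_)
import Data.Integer.Properties as ℤP
import Data.Nat.Coprimality as Coprime
open import Data.Rational using (ℚ; _≤_; _<_; _+_; _*_; 0ℚ; 1ℚ; mkℚ; toℚᵘ; *≤*; *<*)
open import Data.Rational.Properties
import Data.Rational.Unnormalised as ℚᵘ
import Data.Rational.Unnormalised.Properties as ℚᵘP
open import Data.Fin using (Fin; zero; suc; toℕ; inject≤; punchIn)
open import Data.Fin.Properties using (toℕ<n; toℕ-inject≤; inject≤-injective; toℕ-injective; punchInᵢ≢i; punchIn-injective)
open import Data.List using (map; allFin)
open import Data.Nat.ListAction using (sum)
open import Data.Sum using (_⊎_; inj₁; inj₂; [_,_])
open import Data.Sum.Properties using (inj₂-injective)
open import Data.Product using (Σ; _×_; _,_; proj₁; proj₂)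
open import Data.Empty using (⊥-elim)
open import Function using (_∘_)
open import Function.Definitions using (Injective)
open import Relation.Nullary using (¬_; yes; no)
open import Relation.Binary.PropositionalEquality
  using (_≡_; _≢_; refl; sym; trans; cong; cong₂; subst; subst₂; module ≡-Reasoning)

triangular-suc : ∀ n → suc n ℕ.* (suc n ℕ.+ 1) ≡ n ℕ.* (n ℕ.+ 1) ℕ.+ 2 ℕ.* (n ℕ.+ 1)
triangular-suc = solve-∀

-- n(n+1) is even, so the halvings in L and r_i are exact.
triangular-even : ∀ n → 2 ∣ n ℕ.* (n ℕ.+ 1)
triangular-even zero    = divides 0 refl
triangular-even (suc n) rewrite triangular-suc n =
  ∣m∣n⇒∣m+n (triangular-even n) (m∣m*n (n ℕ.+ 1))

lft-step : ∀ B j i → j ℕ.< i → lft B (suc j) ℕ.+ B ℕ.^ 3 ℕ.≤ lft B (suc i)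
lft-step B j i j<i = subst (ℕ._≤ lft B (suc i)) (sym (rearrange (j ℕ.* B ℕ.^ 3) _ (B ℕ.^ 3)))
  (ℕP.+-mono-≤ (ℕP.*-monoˡ-≤ (B ℕ.^ 3) j<i)
               (ℕP.*-monoˡ-≤ B (/-monoˡ-≤ 2 (ℕP.*-mono-≤ (ℕP.<⇒≤ j<i) (ℕ.s≤s (ℕP.<⇒≤ j<i))))))
  where
  rearrange : ∀ p q r → p ℕ.+ q ℕ.+ r ≡ r ℕ.+ p ℕ.+ q
  rearrange = solve-∀

-- If i + 1 < B then l_{i+1} < (i+1)·B³: i + 1 slots of length B³ do not fit
-- before l_{i+1}, because the triangular part i(i+1)/2·B stays below B³.
lft<cubes : ∀ B i → suc i ℕ.< B → lft B (suc i) ℕ.< suc i ℕ.* B ℕ.^ 3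
lft<cubes B i si<B = subst (lft B (suc i) ℕ.<_) (ℕP.+-comm (i ℕ.* B ℕ.^ 3) (B ℕ.^ 3))
  (ℕP.+-monoʳ-< (i ℕ.* B ℕ.^ 3) triangle<cube)
  where
  instance
    B≢0 : ℕ.NonZero B
    B≢0 = ℕ.>-nonZero (ℕP.<-trans ℕ.z<s si<B)
  cube : B ℕ.* B ℕ.* B ≡ B ℕ.^ 3
  cube = trans (ℕP.*-assoc B B B) (cong (λ z → B ℕ.* (B ℕ.* z)) (sym (ℕP.*-identityʳ B)))
  triangle<cube : (i ℕ.* suc i) / 2 ℕ.* B ℕ.< B ℕ.^ 3
  triangle<cube = subst ((i ℕ.* suc i) / 2 ℕ.* B ℕ.<_) cube
    (ℕP.≤-<-trans (ℕP.*-monoˡ-≤ B (m/n≤m (i ℕ.* suc i) 2))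
                  (ℕP.*-monoˡ-< B (ℕP.*-mono-< (ℕP.<-trans (ℕP.n<1+n i) si<B) si<B)))

rgt≡lft-next : ∀ B i → rgt B (suc i) ≡ lft B (suc (suc i))
rgt≡lft-next B i = cong (λ z → suc i ℕ.* B ℕ.^ 3 ℕ.+ (suc i ℕ.* z) / 2 ℕ.* B) (ℕP.+-comm (suc i) 1)

Lbig≡rgt : ∀ m B → Lbig m B ≡ rgt B m
Lbig≡rgt m B = cong (m ℕ.* B ℕ.^ 3 ℕ.+_) (trans (*-/-assoc B (triangular-even m)) (ℕP.*-comm B _))

-- The embedding ⟦_⟧ : ℕ → ℚ is a monotone semiring homomorphism; all proofs go
-- through the normal form n/1 of ⟦ n ⟧.
⟦⟧≡mkℚ : ∀ n → ⟦ n ⟧ ≡ mkℚ (+ n) 0 (Coprime.sym (Coprime.1-coprimeTo n))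
⟦⟧≡mkℚ n = normalize-coprime (Coprime.sym (Coprime.1-coprimeTo n))

⟦⟧-mono-≤ : ∀ {a b} → a ℕ.≤ b → ⟦ a ⟧ ≤ ⟦ b ⟧
⟦⟧-mono-≤ {a} {b} a≤b rewrite ⟦⟧≡mkℚ a | ⟦⟧≡mkℚ b =
  *≤* (subst₂ ℤ._≤_ (sym (ℤP.*-identityʳ (+ a))) (sym (ℤP.*-identityʳ (+ b))) (ℤ.+≤+ a≤b))

⟦⟧-mono-< : ∀ {a b} → a ℕ.< b → ⟦ a ⟧ < ⟦ b ⟧
⟦⟧-mono-< {a} {b} a<b rewrite ⟦⟧≡mkℚ a | ⟦⟧≡mkℚ b =
  *<* (subst₂ ℤ._<_ (sym (ℤP.*-identityʳ (+ a))) (sym (ℤP.*-identityʳ (+ b))) (ℤ.+<+ a<b))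

⟦⟧-homo-+ : ∀ a b → ⟦ a ℕ.+ b ⟧ ≡ ⟦ a ⟧ + ⟦ b ⟧
⟦⟧-homo-+ a b = toℚᵘ-injective (ℚᵘP.≃-trans eq (ℚᵘP.≃-sym (toℚᵘ-homo-+ ⟦ a ⟧ ⟦ b ⟧)))
  where
  eq : toℚᵘ ⟦ a ℕ.+ b ⟧ ℚᵘ.≃ toℚᵘ ⟦ a ⟧ ℚᵘ.+ toℚᵘ ⟦ b ⟧
  eq rewrite ⟦⟧≡mkℚ a | ⟦⟧≡mkℚ b | ⟦⟧≡mkℚ (a ℕ.+ b) = ℚᵘ.*≡* (cong (ℤ._* + 1)
    (trans (ℤP.pos-+ a b) (sym (cong₂ ℤ._+_ (ℤP.*-identityʳ (+ a)) (ℤP.*-identityʳ (+ b))))))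

⟦⟧-homo-* : ∀ a b → ⟦ a ℕ.* b ⟧ ≡ ⟦ a ⟧ * ⟦ b ⟧
⟦⟧-homo-* a b = toℚᵘ-injective (ℚᵘP.≃-trans eq (ℚᵘP.≃-sym (toℚᵘ-homo-* ⟦ a ⟧ ⟦ b ⟧)))
  where
  eq : toℚᵘ ⟦ a ℕ.* b ⟧ ℚᵘ.≃ toℚᵘ ⟦ a ⟧ ℚᵘ.* toℚᵘ ⟦ b ⟧
  eq rewrite ⟦⟧≡mkℚ a | ⟦⟧≡mkℚ b | ⟦⟧≡mkℚ (a ℕ.* b) = ℚᵘ.*≡* (cong (ℤ._* + 1) (ℤP.pos-* a b))

⟦suc⟧-* : ∀ n P → ⟦ suc n ⟧ * P ≡ P + ⟦ n ⟧ * P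
⟦suc⟧-* n P = begin
  ⟦ 1 ℕ.+ n ⟧ * P         ≡⟨ cong (_* P) (⟦⟧-homo-+ 1 n) ⟩
  (1ℚ + ⟦ n ⟧) * P        ≡⟨ *-distribʳ-+ P 1ℚ ⟦ n ⟧ ⟩
  1ℚ * P + ⟦ n ⟧ * P      ≡⟨ cong (_+ ⟦ n ⟧ * P) (*-identityˡ P) ⟩
  P + ⟦ n ⟧ * P           ∎
  where open ≡-Reasoning

<⇒≱ : ∀ {x y} → x < y → ¬ y ≤ x
<⇒≱ x<y y≤x = <-irrefl refl (<-≤-trans x<y y≤x)

<-+-pos : ∀ x {P} → 0ℚ < P → x < x + P
<-+-pos x {P} P>0 = subst (_< x + P) (+-identityʳ x) (+-monoʳ-< x P>0)

+-cancelʳ-≤ : ∀ {x y} P → x + P ≤ y + P → x ≤ y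
+-cancelʳ-≤ {x} {y} P x+P≤y+P with x ≤? y
... | yes x≤y = x≤y
... | no  x≰y = ⊥-elim (<⇒≱ (+-monoˡ-< P (≰⇒> x≰y)) x+P≤y+P)

Overlap : (P x y t : ℚ) → Set
Overlap P x y t = (x ≤ t × t < x + P) × (y ≤ t × t < y + P)

Separated : (P x y : ℚ) → Set
Separated P x y = x + P ≤ y ⊎ y + P ≤ x

-- Disjoint intervals of positive length are separated: otherwise the later
-- start point lies in both intervals.
disjoint⇒separated : ∀ {P} → 0ℚ < P → ∀ x y → (∀ t → ¬ Overlap P x y t) → Separated P x y
disjoint⇒separated {P} P>0 x y disjoint with ≤-total x y
... | inj₁ x≤y with x + P ≤? y
...   | yes x+P≤y = inj₁ x+P≤y
...   | no  x+P≰y = ⊥-elim (disjoint y ((x≤y , ≰⇒> x+P≰y) , (≤-refl , <-+-pos y P>0)))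
disjoint⇒separated {P} P>0 x y disjoint | inj₂ y≤x with y + P ≤? x
...   | yes y+P≤x = inj₂ y+P≤x
...   | no  y+P≰x = ⊥-elim (disjoint x ((≤-refl , <-+-pos x P>0) , (y≤x , ≰⇒> y+P≰x)))

argmax : ∀ n (x : Fin (suc n) → ℚ) → Σ (Fin (suc n)) λ k → ∀ j → x j ≤ x k
argmax zero    x = zero , λ { zero → ≤-refl }
argmax (suc n) x with argmax n (x ∘ suc)
... | k , max with ≤-total (x zero) (x (suc k))
...   | inj₁ x₀≤ = suc k , λ { zero → x₀≤    ; (suc j) → max j }
...   | inj₂ ≤x₀ = zero  , λ { zero → ≤-refl ; (suc j) → ≤-trans (max j) ≤x₀ }

-- Packing: n pairwise separated intervals [x_j, x_j + P) of length P > 0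
-- inside [0, U] have total length n·P ≤ U.  Induction: the interval with the
-- largest start point lies to the right of all the others.
packing : ∀ {P} → 0ℚ < P → ∀ n (x : Fin n → ℚ) (U : ℚ) → 0ℚ ≤ U →
          (∀ j → 0ℚ ≤ x j) → (∀ j → x j + P ≤ U) →
          (∀ j k → j ≢ k → Separated P (x j) (x k)) → ⟦ n ⟧ * P ≤ U
packing {P} P>0 zero    x U U≥0 _ _ _ = subst (_≤ U) (sym (*-zeroˡ P)) U≥0
packing {P} P>0 (suc n) x U U≥0 x≥0 x+P≤U separated with argmax n x
... | k , max = begin
  ⟦ suc n ⟧ * P  ≡⟨ ⟦suc⟧-* n P ⟩
  P + ⟦ n ⟧ * P  ≤⟨ +-monoʳ-≤ P others-fit ⟩
  P + x k        ≡⟨ +-comm P (x k) ⟩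
  x k + P        ≤⟨ x+P≤U k ⟩
  U              ∎
  where
  open ≤-Reasoning
  y : Fin n → ℚ
  y = x ∘ punchIn k
  y-before-k : ∀ j → y j + P ≤ x k
  y-before-k j with separated (punchIn k j) k (punchInᵢ≢i k j)
  ... | inj₁ before = before
  ... | inj₂ after  = ⊥-elim (<⇒≱ (<-+-pos (x k) P>0) (≤-trans after (max (punchIn k j))))
  others-fit : ⟦ n ⟧ * P ≤ x k
  others-fit = packing P>0 n y (x k) (x≥0 k) (x≥0 ∘ punchIn k) y-before-k
    (λ j j' j≢j' → separated _ _ (j≢j' ∘ punchIn-injective k j j'))

feasible-restrict : {I K : Set} (task : I → Task) (s : I → ℚ) (f : K → I) →
                    Injective _≡_ _≡_ f → Feasible task s → Feasible (task ∘ f) (s ∘ f)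
feasible-restrict task s f f-inj (nonneg , on-time , disjoint) =
  (nonneg ∘ f) , (on-time ∘ f) , λ x y x≢y → disjoint (f x) (f y) (x≢y ∘ f-inj)

-- A feasible schedule s̃ of the tasks J̃_1, …, J̃_m alone (J̃_{i+1} indexed by i).
module J̃Schedule (B : ℕ) (B>0 : 0 ℕ.< B) {m : ℕ} (s̃ : Fin m → ℚ)
  (feasible : Feasible (λ i → taskJ̃ B (suc (toℕ i))) s̃) where

  instance
    B≢0 : ℕ.NonZero B
    B≢0 = ℕ.>-nonZero B>0

  P : ℚ
  P = ⟦ B ℕ.^ 3 ⟧

  P>0 : 0ℚ < P
  P>0 = ⟦⟧-mono-< (ℕP.m^n>0 B 3)

  nonneg : ∀ i → 0ℚ ≤ s̃ i
  nonneg = proj₁ feasible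

  on-time : ∀ i → s̃ i + P ≤ ⟦ lft B (suc (toℕ i)) ℕ.+ B ℕ.^ 3 ⟧
  on-time = proj₁ (proj₂ feasible)

  separated : ∀ i k → i ≢ k → Separated P (s̃ i) (s̃ k)
  separated i k i≢k =
    disjoint⇒separated P>0 (s̃ i) (s̃ k) (proj₂ (proj₂ feasible) i k i≢k)

  earlier-finish-by : ∀ i → s̃ i + P ≤ ⟦ lft B (suc (toℕ i)) ⟧ →
                      ∀ k → toℕ k ℕ.≤ toℕ i → s̃ k + P ≤ ⟦ lft B (suc (toℕ i)) ⟧
  earlier-finish-by i i-done k k≤i with ℕP.m≤n⇒m<n∨m≡n k≤i
  ... | inj₁ k<i = ≤-trans (on-time k) (⟦⟧-mono-≤ (lft-step B (toℕ k) (toℕ i) k<i))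
  ... | inj₂ k≡i = subst (λ k → s̃ k + P ≤ ⟦ lft B (suc (toℕ i)) ⟧) (sym (toℕ-injective k≡i)) i-done

  first-tasks-pack : ∀ i → s̃ i + P ≤ ⟦ lft B (suc (toℕ i)) ⟧ →
                     ⟦ suc (toℕ i) ℕ.* B ℕ.^ 3 ⟧ ≤ ⟦ lft B (suc (toℕ i)) ⟧
  first-tasks-pack i i-done = subst (_≤ ⟦ lft B (suc (toℕ i)) ⟧) (sym (⟦⟧-homo-* (suc (toℕ i)) (B ℕ.^ 3)))
    (packing P>0 (suc (toℕ i)) (s̃ ∘ prefix) ⟦ lft B (suc (toℕ i)) ⟧ (⟦⟧-mono-≤ {b = lft B (suc (toℕ i))} ℕ.z≤n)
      (nonneg ∘ prefix)
      (λ j → earlier-finish-by i i-done (prefix j) (ℕP.≤-trans (ℕP.≤-reflexive (toℕ-inject≤ j i<m)) (ℕP.≤-pred (toℕ<n j))))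
      (λ j j' j≢j' → separated (prefix j) (prefix j') (j≢j' ∘ inject≤-injective i<m i<m j j')))
    where
    i<m : suc (toℕ i) ℕ.≤ m
    i<m = toℕ<n i
    prefix : Fin (suc (toℕ i)) → Fin m
    prefix j = inject≤ j i<m

  -- Lower end: C̃_{i+1} ≥ l_{i+1}, as otherwise (i+1)·B³ ≤ l_{i+1} < (i+1)·B³.
  lft≤completion : ∀ i → suc (toℕ i) ℕ.< B → ⟦ lft B (suc (toℕ i)) ⟧ ≤ s̃ i + P
  lft≤completion i i<B with ⟦ lft B (suc (toℕ i)) ⟧ ≤? s̃ i + P
  ... | yes l≤C = l≤C
  ... | no  l≰C = ⊥-elim (<⇒≱ (⟦⟧-mono-< (lft<cubes B (toℕ i) i<B))
                               (first-tasks-pack i (<⇒≤ (≰⇒> l≰C))))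

  -- Upper end: J̃_{i+2} starts by r_{i+1} = l_{i+2}, since its deadline is l_{i+2} + B³.
  start≤rgt : (i i' : Fin m) → toℕ i' ≡ suc (toℕ i) → s̃ i' ≤ ⟦ rgt B (suc (toℕ i)) ⟧
  start≤rgt i i' i'≡i+1 = +-cancelʳ-≤ P (subst (s̃ i' + P ≤_) deadline≡ (on-time i'))
    where
    open ≡-Reasoning
    deadline≡ : ⟦ lft B (suc (toℕ i')) ℕ.+ B ℕ.^ 3 ⟧ ≡ ⟦ rgt B (suc (toℕ i)) ⟧ + P
    deadline≡ = begin
      ⟦ lft B (suc (toℕ i')) ℕ.+ B ℕ.^ 3 ⟧    ≡⟨ cong (λ k → ⟦ lft B (suc k) ℕ.+ B ℕ.^ 3 ⟧) i'≡i+1 ⟩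
      ⟦ lft B (suc (suc (toℕ i))) ℕ.+ B ℕ.^ 3 ⟧ ≡⟨ cong (λ z → ⟦ z ℕ.+ B ℕ.^ 3 ⟧) (sym (rgt≡lft-next B (toℕ i))) ⟩
      ⟦ rgt B (suc (toℕ i)) ℕ.+ B ℕ.^ 3 ⟧      ≡⟨ ⟦⟧-homo-+ (rgt B (suc (toℕ i))) (B ℕ.^ 3) ⟩
      ⟦ rgt B (suc (toℕ i)) ⟧ + P              ∎

  inner-gap⊆I : (i i' : Fin m) → toℕ i' ≡ suc (toℕ i) → suc (toℕ i) ℕ.< B → ∀ t →
                s̃ i + P ≤ t → t < s̃ i' → ⟦ lft B (suc (toℕ i)) ⟧ ≤ t × t < ⟦ rgt B (suc (toℕ i)) ⟧
  inner-gap⊆I i i' i'≡i+1 i<B t C̃≤t t<s̃' =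
    ≤-trans (lft≤completion i i<B) C̃≤t , <-≤-trans t<s̃' (start≤rgt i i' i'≡i+1)

  last-gap⊆I : (i : Fin m) → suc (toℕ i) ≡ m → m ℕ.< B → ∀ t →
               s̃ i + P ≤ t → t < ⟦ Lbig m B ⟧ → ⟦ lft B (suc (toℕ i)) ⟧ ≤ t × t < ⟦ rgt B (suc (toℕ i)) ⟧
  last-gap⊆I i i+1≡m m<B t C̃≤t t<L =
    ≤-trans (lft≤completion i (subst (ℕ._< B) (sym i+1≡m) m<B)) C̃≤t ,
    subst (t <_) (cong ⟦_⟧ (trans (Lbig≡rgt m B) (cong (rgt B) (sym i+1≡m)))) t<L

lemma7 : (m B : ℕ) → 0 ℕ.< m → 0 ℕ.< B → m ℕ.< B →
    (a : Fin (3 ℕ.* m) → ℕ) →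
    (∀ j → 0 ℕ.< a j) →
    sum (map a (allFin (3 ℕ.* m))) ≡ m ℕ.* B →
    (∀ j → B ℕ.< 4 ℕ.* a j × 2 ℕ.* a j ℕ.< B) →
    (s : Fin (3 ℕ.* m) ⊎ Fin m → ℚ) →
    Feasible [ (λ j → taskJ m B (a j)) , (λ i → taskJ̃ B (suc (toℕ i))) ] s →
    ((i i' : Fin m) → toℕ i' ≡ suc (toℕ i) → (t : ℚ) →
    completion (taskJ̃ B (suc (toℕ i))) (s (inj₂ i)) ≤ t → t < s (inj₂ i') →
    ⟦ lft B (suc (toℕ i)) ⟧ ≤ t × t < ⟦ rgt B (suc (toℕ i)) ⟧)
    ×
    ((i : Fin m) → suc (toℕ i) ≡ m → (t : ℚ) →
    completion (taskJ̃ B (suc (toℕ i))) (s (inj₂ i)) ≤ t → t < ⟦ Lbig m B ⟧ →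
    ⟦ lft B (suc (toℕ i)) ⟧ ≤ t × t < ⟦ rgt B (suc (toℕ i)) ⟧)
lemma7 m B _ B>0 m<B a _ _ _ s feasible =
  (λ i i' i'≡i+1 → inner-gap⊆I i i' i'≡i+1 (ℕP.≤-<-trans (toℕ<n i) m<B)) ,
  (λ i i+1≡m → last-gap⊆I i i+1≡m m<B)
  where
  tasks : Fin (3 ℕ.* m) ⊎ Fin m → Task
  tasks = [ (λ j → taskJ m B (a j)) , (λ i → taskJ̃ B (suc (toℕ i))) ]
  open J̃Schedule B B>0 (s ∘ inj₂) (feasible-restrict tasks s inj₂ inj₂-injective feasible)
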